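{- Let $(\mathbb{D},\preceq)$ be a directed set with an explicit majorization $\vee$, i.e., a map $(i,j)\mapsto i\vee j$ from $\mathbb{D}\times\mathbb{D}$ to $\mathbb{D}$ with $i\vee j\succeq i$ and $i\vee j\succeq j$ for all $i,j\in\mathbb{D}$. For every nonempty finite subset $S\subseteq\mathbb{D}\times\mathbb{D}$, all $\epsilon>0$, all samplings $\eta$ of $\mathbb{D}$ and all $\mathbb{D}$-nets $c_\bullet=(c_i:i\in\mathbb{D})$ in some metric space $(Y,d)$: if $S$ is a rate of pointed $[\epsilon,\check{\eta}]$-metastability for the real $(\mathbb{D}\times\mathbb{D})$-net $d(c_\bullet,c_\bullet)=(d(c_i,c_j):(i,j)\in\mathbb{D}\times\mathbb{D})$ near $0$, then $S^{\vee}$ is a rate of $[\epsilon,\eta]$-metastability for $c_\bullet$. In particular, if $E_\bullet=(E_{\epsilon,\zeta})$ is a rate of pointed metastability for $d(c_\bullet,c_\bullet)$ near $0$, then $E_\bullet^{\vee}$ is a rate of metastability for $c_\bullet$.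
   Context: A directed set is a nonempty set $\mathbb{D}$ with a non-strict partial order $\preceq$ in which every two elements have an upper bound and there is no largest element; $\mathbb{D}_{\succeq i}=\{j\in\mathbb{D}: i\preceq j\}$. A sampling of $\mathbb{D}$ is a family $\eta=(\eta_i:i\in\mathbb{D})$ of nonempty finite subsets with $\eta_i\subseteq\mathbb{D}_{\succeq i}$. The product $\mathbb{D}\times\mathbb{D}$ is directed by $(i,j)\sqsubseteq(k,l)$ iff $i\preceq k$ and $j\preceq l$. A $\mathbb{D}$-net $a_\bullet$ in a metric space is $[\epsilon,\eta]$-metastable, witnessed by $i$, if $d(a_j,a_k)\le\epsilon$ for all $j,k\in\eta_i$; it is pointed $[\epsilon,\eta]$-metastable near $b$, witnessed by $i$, if $d(a_j,b)\le\epsilon$ for all $j\in\eta_i$. A finite set $F$ is a rate of (pointed) $[\epsilon,\eta]$-metastability for a net if some $i\in F$ witnesses the corresponding property; a rate of metastability $E_\bullet=(E_{\epsilon,\eta})$ is a family of nonempty finite subsets indexed by $\epsilon>0$ and samplings $\eta$, such that each $E_{\epsilon,\eta}$ is such a rate. Given a sampling $\eta$ of $\mathbb{D}$ and the explicit majorization $\vee$, $\check{\eta}:=(\eta_{i\vee j}\times\eta_{i\vee j}:(i,j)\in\mathbb{D}\times\mathbb{D})$ is the induced sampling of $\mathbb{D}\times\mathbb{D}$. For $S\subseteq\mathbb{D}\times\mathbb{D}$, $S^{\vee}:=\{i\vee j:(i,j)\in S\}$, and for a rate $E_\bullet=(E_{\epsilon,\zeta})$ for $(\mathbb{D}\times\mathbb{D})$-nets,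 $E_\bullet^{\vee}:=((E_{\epsilon,\check{\eta}})^{\vee})_{\epsilon,\eta}$. -}

module Defs where

open import Data.Product using (Σ; Σ-syntax; _×_; _,_; proj₁; proj₂)
open import Data.Sum using (_⊎_)
open import Data.List using (List; []; _∷_; map; cartesianProduct)
open import Data.List.Membership.Propositional using (_∈_)
open import Data.List.Membership.Propositional.Properties using (∈-cartesianProduct⁻)
open import Data.List.Relation.Unary.Any using (Any)
open import Relation.Binary.PropositionalEquality using (_≡_; _≢_; refl)
open import Relation.Binary.Structures using (IsPartialOrder; IsTotalOrder)
open import Algebra.Structures using (IsCommutativeRing)
open import Relation.Nullary using (¬_)

-- The real numbers, axiomatised as a Dedekind-complete ordered field.
-- (agda-stdlib has no reals; the theorem is stated for every model.)

record Reals : Set₁ where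
  field
    ℝ    : Set
    _+_  : ℝ → ℝ → ℝ
    _*_  : ℝ → ℝ → ℝ
    -_   : ℝ → ℝ
    0ℝ   : ℝ
    1ℝ   : ℝ
    _≤_  : ℝ → ℝ → Set
    isCommutativeRing : IsCommutativeRing _≡_ _+_ _*_ -_ 0ℝ 1ℝ
    0≢1  : 0ℝ ≢ 1ℝ
    inverse : ∀ x → x ≢ 0ℝ → Σ ℝ λ y → x * y ≡ 1ℝ
    isTotalOrder : IsTotalOrder _≡_ _≤_
    +-mono-≤ : ∀ {x y} z → x ≤ y → (x + z) ≤ (y + z)
    *-nonneg : ∀ {x y} → 0ℝ ≤ x → 0ℝ ≤ y → 0ℝ ≤ (x * y)
    lub : (P : ℝ → Set) → Σ ℝ P → (Σ ℝ λ b → ∀ x → P x → x ≤ b) →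
          Σ ℝ λ s → (∀ x → P x → x ≤ s) × (∀ b → (∀ x → P x → x ≤ b) → s ≤ b)

  _-_ : ℝ → ℝ → ℝ
  x - y = x + (- y)

  _<_ : ℝ → ℝ → Set
  x < y = (x ≤ y) × (x ≢ y)

  ∣_∣ : ℝ → ℝ
  ∣ x ∣ with IsTotalOrder.total isTotalOrder 0ℝ x
  ... | Data.Sum.inj₁ _ = x
  ... | Data.Sum.inj₂ _ = - x

record MetricSpace (R : Reals) : Set₁ where
  open Reals R
  field
    Y : Set
    d : Y → Y → ℝ
    d-zero⇒≡ : ∀ x y → d x y ≡ 0ℝ → x ≡ y
    d-refl   : ∀ x → d x x ≡ 0ℝ
    d-sym    : ∀ x y → d x y ≡ d y x
    d-triangle : ∀ x y z → d x z ≤ (d x y + d y z)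

record DirectedSet : Set₁ where
  field
    D   : Set
    _≼_ : D → D → Set
    isPartialOrder : IsPartialOrder _≡_ _≼_
    upperBound : ∀ i j → Σ D λ k → (i ≼ k) × (j ≼ k)
    noLargest  : ¬ (Σ D λ i → ∀ j → j ≼ i)
    nonempty   : D

record Majorization (𝔻 : DirectedSet) : Set where
  open DirectedSet 𝔻
  field
    _∨_ : D → D → D
    ∨-upperˡ : ∀ i j → i ≼ (i ∨ j)
    ∨-upperʳ : ∀ i j → j ≼ (i ∨ j)

-- Samplings of a preordered index set (A, ≼); finite subsets are lists.

record Sampling {A : Set} (_≼_ : A → A → Set) : Set where
  field
    η        : A → List A
    nonEmpty : ∀ i → η i ≢ []
    above    : ∀ i j → j ∈ η i → i ≼ j
open Sampling public

_⊑_ : {D : Set} (_≼_ : D → D → Set) → (D × D) → (D × D) → Set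
(_≼_ ⊑ (i , j)) (k , l) = (i ≼ k) × (j ≼ l)

module _ (R : Reals) where
  open Reals R

  Metastable : {A Y : Set} {_≼_ : A → A → Set} (d : Y → Y → ℝ) (a : A → Y) →
               ℝ → Sampling _≼_ → A → Set
  Metastable d a ε η' i = ∀ j k → j ∈ η η' i → k ∈ η η' i → d (a j) (a k) ≤ ε

  PointedMetastable : {A Y : Set} {_≼_ : A → A → Set} (d : Y → Y → ℝ) (a : A → Y) →
                      ℝ → Sampling _≼_ → Y → A → Set
  PointedMetastable d a ε η' b i = ∀ j → j ∈ η η' i → d (a j) b ≤ ε

  IsRate : {A Y : Set} {_≼_ : A → A → Set} (d : Y → Y → ℝ) (a : A → Y) →
           ℝ → Sampling _≼_ → List A → Set
  IsRate d a ε η' F = Any (Metastable d a ε η') F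

  IsPointedRate : {A Y : Set} {_≼_ : A → A → Set} (d : Y → Y → ℝ) (a : A → Y) →
                  ℝ → Sampling _≼_ → Y → List A → Set
  IsPointedRate d a ε η' b F = Any (PointedMetastable d a ε η' b) F

  RateFamily : {A : Set} (_≼_ : A → A → Set) → Set
  RateFamily {A} _≼_ = (ε : ℝ) → 0ℝ < ε → Sampling _≼_ → List A

  IsRateOfMetastability : {A Y : Set} {_≼_ : A → A → Set} (d : Y → Y → ℝ) (a : A → Y) →
                          RateFamily _≼_ → Set
  IsRateOfMetastability d a E =
    ∀ ε (p : 0ℝ < ε) η' → (E ε p η' ≢ []) × IsRate d a ε η' (E ε p η')

  IsPointedRateOfMetastability : {A Y : Set} {_≼_ : A → A → Set} (d : Y → Y → ℝ) (a : A → Y) →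
                                 Y → RateFamily _≼_ → Set
  IsPointedRateOfMetastability d a b E =
    ∀ ε (p : 0ℝ < ε) η' → (E ε p η' ≢ []) × IsPointedRate d a ε η' b (E ε p η')

  dℝ : ℝ → ℝ → ℝ
  dℝ x y = ∣ x - y ∣

module _ (𝔻 : DirectedSet) (M : Majorization 𝔻) where
  open DirectedSet 𝔻
  open Majorization M

  private
    ×-nonEmpty : ∀ {B : Set} (xs : List B) → xs ≢ [] → cartesianProduct xs xs ≢ []
    ×-nonEmpty [] ne _ = ne refl
    ×-nonEmpty (x ∷ xs) ne ()

    trans≼ : ∀ {i j k} → i ≼ j → j ≼ k → i ≼ k
    trans≼ = IsPartialOrder.trans isPartialOrder

  check : Sampling _≼_ → Sampling (_≼_ ⊑_)
  check s = record
    { η = λ { (i , j) → cartesianProduct (η s (i ∨ j)) (η s (i ∨ j)) }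
    ; nonEmpty = λ { (i , j) → ×-nonEmpty (η s (i ∨ j)) (nonEmpty s (i ∨ j)) }
    ; above = λ { (i , j) (k , l) mem →
        let (k∈ , l∈) = ∈-cartesianProduct⁻ (η s (i ∨ j)) (η s (i ∨ j)) mem in
        trans≼ (∨-upperˡ i j) (above s (i ∨ j) k k∈) ,
        trans≼ (∨-upperʳ i j) (above s (i ∨ j) l l∈) }
    }

  _^∨ : List (D × D) → List D
  S ^∨ = map (λ { (i , j) → i ∨ j }) S

  family^∨ : (R : Reals) → RateFamily R (_≼_ ⊑_) → RateFamily R _≼_
  family^∨ R E ε p η' = E ε p (check η') ^∨

module Submission where

open import Defs
open import Data.Product using (_×_; _,_; proj₁)
open import Data.List using (List; []; _∷_; map)
import Data.List.Relation.Unary.Any as Any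
open import Data.List.Relation.Unary.Any.Properties using (map⁺)
open import Data.List.Membership.Propositional.Properties using (∈-cartesianProduct⁺)
open import Data.Sum using (inj₁; inj₂)
open import Function using (_∘_)
open import Relation.Binary.PropositionalEquality using (_≡_; _≢_; refl; subst; trans; cong)
open import Relation.Binary.Structures using (IsTotalOrder)
open import Algebra.Bundles using (CommutativeRing)
import Algebra.Properties.Ring as RingProperties

-- A witness (i , j) of pointed metastability of d(c,c) near 0 bounds d(c_k, c_l) for all
-- (k , l) ∈ η̌_(i,j) = η_(i∨j) × η_(i∨j), which is exactly [ε, η]-metastability of c
-- witnessed by i ∨ j; the only real analysis needed is x ≤ |x - 0| ≤ ε.

module RealProperties (R : Reals) where
  open Reals R
  open IsTotalOrder isTotalOrder using (total) renaming (trans to ≤-trans)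

  commutativeRing : CommutativeRing _ _
  commutativeRing = record { isCommutativeRing = isCommutativeRing }

  open CommutativeRing commutativeRing using (+-identityʳ; ring)
  open RingProperties ring using (-0#≈0#)

  x-0≡x : ∀ x → x - 0ℝ ≡ x
  x-0≡x x = trans (cong (x +_) -0#≈0#) (+-identityʳ x)

  ∣x∣≤ε⇒x≤ε : ∀ {x ε} → 0ℝ ≤ ε → ∣ x ∣ ≤ ε → x ≤ ε
  ∣x∣≤ε⇒x≤ε {x} 0≤ε ∣x∣≤ε with total 0ℝ x
  ... | inj₁ _   = ∣x∣≤ε
  ... | inj₂ x≤0 = ≤-trans x≤0 0≤ε

  dℝ[x,0]≤ε⇒x≤ε : ∀ {x ε} → 0ℝ ≤ ε → dℝ R x 0ℝ ≤ ε → x ≤ ε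
  dℝ[x,0]≤ε⇒x≤ε {x} {ε} 0≤ε = ∣x∣≤ε⇒x≤ε 0≤ε ∘ subst (λ y → ∣ y ∣ ≤ ε) (x-0≡x x)

map-≢[] : ∀ {A B : Set} (f : A → B) {xs : List A} → xs ≢ [] → map f xs ≢ []
map-≢[] f {[]}    xs≢[] _ = xs≢[] refl
map-≢[] f {_ ∷ _} _      ()

module _ (R : Reals) (𝔻 : DirectedSet) (M : Majorization 𝔻) (X : MetricSpace R) where
  open Reals R
  open DirectedSet 𝔻
  open Majorization M
  open MetricSpace X
  open RealProperties R

  module _ {ε : ℝ} (0<ε : 0ℝ < ε) (η' : Sampling _≼_) (c : D → Y) where

    pointedMetastable⇒metastable-∨ : ∀ {i j} →
      PointedMetastable R (dℝ R) (λ { (k , l) → d (c k) (c l) }) ε (check 𝔻 M η') 0ℝ (i , j) →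
      Metastable R d c ε η' (i ∨ j)
    pointedMetastable⇒metastable-∨ pm k l k∈ l∈ =
      dℝ[x,0]≤ε⇒x≤ε (proj₁ 0<ε) (pm (k , l) (∈-cartesianProduct⁺ k∈ l∈))

    isPointedRate⇒isRate-^∨ : ∀ S →
      IsPointedRate R (dℝ R) (λ { (i , j) → d (c i) (c j) }) ε (check 𝔻 M η') 0ℝ S →
      IsRate R d c ε η' (_^∨ 𝔻 M S)
    isPointedRate⇒isRate-^∨ S = map⁺ ∘ Any.map pointedMetastable⇒metastable-∨

proposition3p10 : (R : Reals) (𝔻 : DirectedSet) (M : Majorization 𝔻) (X : MetricSpace R) →
    let open Reals R
        open DirectedSet 𝔻
        open MetricSpace X
    in
    ((S : List (D × D)) → S ≢ [] → (ε : ℝ) → 0ℝ < ε → (η' : Sampling _≼_) → (c : D → Y) →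
       IsPointedRate R (dℝ R) (λ { (i , j) → d (c i) (c j) }) ε (check 𝔻 M η') 0ℝ S →
       IsRate R d c ε η' (_^∨ 𝔻 M S))
    ×
    ((c : D → Y) → (E : RateFamily R (_⊑_ _≼_)) →
       IsPointedRateOfMetastability R (dℝ R) (λ { (i , j) → d (c i) (c j) }) 0ℝ E →
       IsRateOfMetastability R d c (family^∨ 𝔻 M R E))
proposition3p10 R 𝔻 M X =
  (λ S _ ε 0<ε η' c → isPointedRate⇒isRate-^∨ R 𝔻 M X 0<ε η' c S) ,
  λ c E rate ε 0<ε η' →
    let (E≢[] , pointedRate) = rate ε 0<ε (check 𝔻 M η')
    in map-≢[] _ E≢[] , isPointedRate⇒isRate-^∨ R 𝔻 M X 0<ε η' c _ pointedRate
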